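{- For all $n_1,n_2\in\mathbb{N}$, $a(n_1+n_2)\le a(n_1)+a(n_2)$.
   Context: The sequence $(a(n))_{n\ge1}$ is defined by $a(1)=1$; $a(2^k-1+i)=2^{k-1}+a(i)$ for $1\le i\le 2^k-1$, $k\in\mathbb{N}$; and $a(2^{k+1}-1)=2^k$ for $k\in\mathbb{N}$ (so it begins $1,2,2,3,4,4,4,5,6,6,7,8,8,8,8,9,\dots$). -}

module Defs where

open import Data.Nat using (ℕ; zero; suc; _+_; _∸_; _^_; _≡ᵇ_)
open import Data.Nat.Logarithm using (⌊log₂_⌋)
open import Data.Bool using (if_then_else_)

-- For n ≥ 1 let k = ⌊log₂ n⌋,
-- so 2^k ≤ n ≤ 2^(k+1) - 1.
--   * if n = 2^(k+1) - 1 then a(n) = 2^k;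
--   * otherwise k ≥ 1 and n = 2^k - 1 + i with 1 ≤ i = n + 1 - 2^k ≤ 2^k - 1,
--     and a(n) = 2^(k-1) + a(i), where i < n.
-- (a(1) = 1 is the case n = 2^1 - 1.)  Fuel n suffices since i < n.
a-fuel : ℕ → ℕ → ℕ
a-fuel zero    n = 0
a-fuel (suc f) n =
  if suc n ≡ᵇ 2 ^ suc ⌊log₂ n ⌋
  then 2 ^ ⌊log₂ n ⌋
  else 2 ^ (⌊log₂ n ⌋ ∸ 1) + a-fuel f (suc n ∸ 2 ^ ⌊log₂ n ⌋)

-- The sequence a(n), meaningful for n ≥ 1 (a 0 = 0 is a junk value).
a : ℕ → ℕ
a n = a-fuel n n

-- Let s₂ be the binary digit sum and read n ⊑ m as n ≤ 2m − s₂ m.  Carries only lose digits,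
-- so s₂ is subadditive and ⊑ is preserved by adding relations side by side.  Unwinding the
-- recursion of a shows that a n is the least m with n ⊑ m.  Hence n₁ ⊑ a n₁ and n₂ ⊑ a n₂
-- give n₁ + n₂ ⊑ a n₁ + a n₂, and minimality yields a (n₁ + n₂) ≤ a n₁ + a n₂.

module Submission where

open import Defs
open import Data.Bool using (true; false; if_then_else_)
open import Data.Nat
open import Data.Nat.Induction using (<-rec)
open import Data.Nat.Logarithm
open import Data.Nat.Properties
open import Algebra.Properties.CommutativeSemigroup +-commutativeSemigroup using (interchange)
open import Relation.Binary.PropositionalEquality
open import Relation.Nullary using (yes; no; contradiction)

m+m<n+n⇒m<n : ∀ {m n} → m + m < n + n → m < n
m+m<n+n⇒m<n lt = ≰⇒> λ n≤m → <⇒≱ lt (+-mono-≤ n≤m n≤m)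

m+m≤1+n+n⇒m≤n : ∀ {m n} → m + m ≤ suc (n + n) → m ≤ n
m+m≤1+n+n⇒m≤n {m} {n} le =
  ≤-pred (m+m<n+n⇒m<n {m} {suc n} (≤-trans (s≤s le) (≤-reflexive (cong suc (sym (+-suc n n))))))

2^[1+k]≡2^k+2^k : ∀ k → 2 ^ suc k ≡ 2 ^ k + 2 ^ k
2^[1+k]≡2^k+2^k k = cong (2 ^ k +_) (+-identityʳ (2 ^ k))

2≤2^[1+k] : ∀ k → 2 ≤ 2 ^ suc k
2≤2^[1+k] k = ^-monoʳ-≤ 2 {1} {suc k} (s≤s z≤n)

lowBit : ℕ → ℕ
lowBit zero          = 0
lowBit (suc zero)    = 1
lowBit (suc (suc n)) = lowBit n

lowBit[n+n]≡0 : ∀ n → lowBit (n + n) ≡ 0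
lowBit[n+n]≡0 zero    = refl
lowBit[n+n]≡0 (suc n) rewrite +-suc n n = lowBit[n+n]≡0 n

lowBit[1+n+n]≡1 : ∀ n → lowBit (suc (n + n)) ≡ 1
lowBit[1+n+n]≡1 zero    = refl
lowBit[1+n+n]≡1 (suc n) rewrite +-suc n n = lowBit[1+n+n]≡1 n

s₂-fuel : ℕ → ℕ → ℕ
s₂-fuel zero    _       = 0
s₂-fuel (suc f) zero    = 0
s₂-fuel (suc f) (suc n) = lowBit (suc n) + s₂-fuel f ⌊ suc n /2⌋

-- The binary digit sum; fuel n suffices since halving decreases a positive number.
s₂ : ℕ → ℕ
s₂ n = s₂-fuel n n

s₂-fuel-irrelevant : ∀ {f g n} → n ≤ f → n ≤ g → s₂-fuel f n ≡ s₂-fuel g n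
s₂-fuel-irrelevant {zero}  {zero}  {zero}  _ _ = refl
s₂-fuel-irrelevant {zero}  {suc g} {zero}  _ _ = refl
s₂-fuel-irrelevant {suc f} {zero}  {zero}  _ _ = refl
s₂-fuel-irrelevant {suc f} {suc g} {zero}  _ _ = refl
s₂-fuel-irrelevant {suc f} {suc g} {suc n} (s≤s n≤f) (s≤s n≤g) =
  cong (lowBit (suc n) +_) (s₂-fuel-irrelevant (≤-trans half≤n n≤f) (≤-trans half≤n n≤g))
  where
  half≤n : ⌊ suc n /2⌋ ≤ n
  half≤n = ≤-pred (⌊n/2⌋<n n)

s₂-unfold : ∀ n → s₂ n ≡ lowBit n + s₂ ⌊ n /2⌋
s₂-unfold zero    = refl
s₂-unfold (suc n) = cong (lowBit (suc n) +_) (s₂-fuel-irrelevant (≤-pred (⌊n/2⌋<n n)) ≤-refl)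

s₂[n+n]≡s₂n : ∀ n → s₂ (n + n) ≡ s₂ n
s₂[n+n]≡s₂n n = begin
  s₂ (n + n)                             ≡⟨ s₂-unfold (n + n) ⟩
  lowBit (n + n) + s₂ ⌊ n + n /2⌋        ≡⟨ cong₂ _+_ (lowBit[n+n]≡0 n) (cong s₂ (sym (n≡⌊n+n/2⌋ n))) ⟩
  s₂ n                                   ∎
  where open ≡-Reasoning

s₂[1+n+n]≡1+s₂n : ∀ n → s₂ (suc (n + n)) ≡ suc (s₂ n)
s₂[1+n+n]≡1+s₂n n = begin
  s₂ (suc (n + n))                             ≡⟨ s₂-unfold (suc (n + n)) ⟩
  lowBit (suc (n + n)) + s₂ ⌈ n + n /2⌉        ≡⟨ cong₂ _+_ (lowBit[1+n+n]≡1 n) (cong s₂ (sym (n≡⌈n+n/2⌉ n))) ⟩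
  suc (s₂ n)                                   ∎
  where open ≡-Reasoning

data Binary : ℕ → Set where
  zero : Binary 0
  even : ∀ {n} → Binary n → Binary (n + n)
  odd  : ∀ {n} → Binary n → Binary (suc (n + n))

binary-suc : ∀ {n} → Binary n → Binary (suc n)
binary-suc zero           = odd zero
binary-suc (even b)       = odd b
binary-suc (odd {n} b)    = subst Binary (cong suc (+-suc n n)) (even (binary-suc b))

binary : ∀ n → Binary n
binary zero    = zero
binary (suc n) = binary-suc (binary n)

s₂[1+n]≤1+s₂n : ∀ n → s₂ (suc n) ≤ suc (s₂ n)
s₂[1+n]≤1+s₂n n = go (binary n)
  where
  open ≤-Reasoning
  go : ∀ {n} → Binary n → s₂ (suc n) ≤ suc (s₂ n)
  go zero         = ≤-refl
  go (even {n} _) = ≤-reflexive (trans (s₂[1+n+n]≡1+s₂n n) (cong suc (sym (s₂[n+n]≡s₂n n))))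
  go (odd {n} b)  = begin
    s₂ (suc (suc (n + n)))  ≡⟨ cong s₂ (cong suc (sym (+-suc n n))) ⟩
    s₂ (suc n + suc n)      ≡⟨ s₂[n+n]≡s₂n (suc n) ⟩
    s₂ (suc n)              ≤⟨ m≤n⇒m≤1+n (go b) ⟩
    suc (suc (s₂ n))        ≡⟨ cong suc (sym (s₂[1+n+n]≡1+s₂n n)) ⟩
    suc (s₂ (suc (n + n)))  ∎

s₂-subadditive : ∀ m n → s₂ (m + n) ≤ s₂ m + s₂ n
s₂-subadditive m n = go (binary m) (binary n)
  where
  open ≤-Reasoning
  go : ∀ {m n} → Binary m → Binary n → s₂ (m + n) ≤ s₂ m + s₂ n
  go zero _ = ≤-refl
  go {m} _ zero = ≤-reflexive (trans (cong s₂ (+-identityʳ m)) (sym (+-identityʳ (s₂ m))))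
  go (even {x} a) (even {y} b) = begin
    s₂ ((x + x) + (y + y))         ≡⟨ cong s₂ (interchange x x y y) ⟩
    s₂ ((x + y) + (x + y))         ≡⟨ s₂[n+n]≡s₂n (x + y) ⟩
    s₂ (x + y)                     ≤⟨ go a b ⟩
    s₂ x + s₂ y                    ≡⟨ sym (cong₂ _+_ (s₂[n+n]≡s₂n x) (s₂[n+n]≡s₂n y)) ⟩
    s₂ (x + x) + s₂ (y + y)        ∎
  go (even {x} a) (odd {y} b) = begin
    s₂ ((x + x) + suc (y + y))     ≡⟨ cong s₂ (trans (+-suc (x + x) (y + y)) (cong suc (interchange x x y y))) ⟩
    s₂ (suc ((x + y) + (x + y)))   ≡⟨ s₂[1+n+n]≡1+s₂n (x + y) ⟩
    suc (s₂ (x + y))               ≤⟨ s≤s (go a b) ⟩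
    suc (s₂ x + s₂ y)              ≡⟨ sym (+-suc (s₂ x) (s₂ y)) ⟩
    s₂ x + suc (s₂ y)              ≡⟨ sym (cong₂ _+_ (s₂[n+n]≡s₂n x) (s₂[1+n+n]≡1+s₂n y)) ⟩
    s₂ (x + x) + s₂ (suc (y + y))  ∎
  go (odd {x} a) (even {y} b) = begin
    s₂ (suc ((x + x) + (y + y)))   ≡⟨ cong (λ k → s₂ (suc k)) (interchange x x y y) ⟩
    s₂ (suc ((x + y) + (x + y)))   ≡⟨ s₂[1+n+n]≡1+s₂n (x + y) ⟩
    suc (s₂ (x + y))               ≤⟨ s≤s (go a b) ⟩
    suc (s₂ x + s₂ y)              ≡⟨ sym (cong₂ _+_ (s₂[1+n+n]≡1+s₂n x) (s₂[n+n]≡s₂n y)) ⟩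
    s₂ (suc (x + x)) + s₂ (y + y)  ∎
  go (odd {x} a) (odd {y} b) = begin
    s₂ (suc ((x + x) + suc (y + y)))     ≡⟨ cong (λ k → s₂ (suc k)) (trans (+-suc (x + x) (y + y))
                                                (trans (cong suc (interchange x x y y)) (sym (+-suc (x + y) (x + y))))) ⟩
    s₂ (suc (x + y) + suc (x + y))       ≡⟨ s₂[n+n]≡s₂n (suc (x + y)) ⟩
    s₂ (suc (x + y))                     ≤⟨ s₂[1+n]≤1+s₂n (x + y) ⟩
    suc (s₂ (x + y))                     ≤⟨ s≤s (go a b) ⟩
    suc (s₂ x + s₂ y)                    ≤⟨ s≤s (+-monoʳ-≤ (s₂ x) (n≤1+n (s₂ y))) ⟩
    suc (s₂ x + suc (s₂ y))              ≡⟨ sym (cong₂ _+_ (s₂[1+n+n]≡1+s₂n x) (s₂[1+n+n]≡1+s₂n y)) ⟩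
    s₂ (suc (x + x)) + s₂ (suc (y + y))  ∎

s₂[2^k]≡1 : ∀ k → s₂ (2 ^ k) ≡ 1
s₂[2^k]≡1 zero    = refl
s₂[2^k]≡1 (suc k) = trans (cong s₂ (2^[1+k]≡2^k+2^k k)) (trans (s₂[n+n]≡s₂n (2 ^ k)) (s₂[2^k]≡1 k))

s₂[2^k+n]≡1+s₂n : ∀ k {n} → n < 2 ^ k → s₂ (2 ^ k + n) ≡ suc (s₂ n)
s₂[2^k+n]≡1+s₂n zero    (s≤s z≤n) = refl
s₂[2^k+n]≡1+s₂n (suc k) {n} n<2^[1+k] with binary n
... | zero = begin
  s₂ (2 ^ suc k + 0)   ≡⟨ cong s₂ (+-identityʳ (2 ^ suc k)) ⟩
  s₂ (2 ^ suc k)       ≡⟨ s₂[2^k]≡1 (suc k) ⟩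
  1                    ∎
  where open ≡-Reasoning
... | even {y} _ = begin
  s₂ (2 ^ suc k + (y + y))       ≡⟨ cong (λ t → s₂ (t + (y + y))) (2^[1+k]≡2^k+2^k k) ⟩
  s₂ ((t + t) + (y + y))         ≡⟨ cong s₂ (interchange t t y y) ⟩
  s₂ ((t + y) + (t + y))         ≡⟨ s₂[n+n]≡s₂n (t + y) ⟩
  s₂ (t + y)                     ≡⟨ s₂[2^k+n]≡1+s₂n k (m+m<n+n⇒m<n y+y<t+t) ⟩
  suc (s₂ y)                     ≡⟨ cong suc (sym (s₂[n+n]≡s₂n y)) ⟩
  suc (s₂ (y + y))               ∎
  where
  open ≡-Reasoning
  t : ℕ
  t = 2 ^ k
  y+y<t+t : y + y < t + t
  y+y<t+t = subst (y + y <_) (2^[1+k]≡2^k+2^k k) n<2^[1+k]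
... | odd {y} _ = begin
  s₂ (2 ^ suc k + suc (y + y))   ≡⟨ cong (λ t → s₂ (t + suc (y + y))) (2^[1+k]≡2^k+2^k k) ⟩
  s₂ ((t + t) + suc (y + y))     ≡⟨ cong s₂ (trans (+-suc (t + t) (y + y)) (cong suc (interchange t t y y))) ⟩
  s₂ (suc ((t + y) + (t + y)))   ≡⟨ s₂[1+n+n]≡1+s₂n (t + y) ⟩
  suc (s₂ (t + y))               ≡⟨ cong suc (s₂[2^k+n]≡1+s₂n k (m+m<n+n⇒m<n y+y<t+t)) ⟩
  suc (suc (s₂ y))               ≡⟨ cong suc (sym (s₂[1+n+n]≡1+s₂n y)) ⟩
  suc (s₂ (suc (y + y)))         ∎
  where
  open ≡-Reasoning
  t : ℕ
  t = 2 ^ k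
  y+y<t+t : y + y < t + t
  y+y<t+t = <-trans (n<1+n (y + y)) (subst (suc (y + y) <_) (2^[1+k]≡2^k+2^k k) n<2^[1+k])

⌊n/2⌋+⌊n/2⌋≤n : ∀ n → ⌊ n /2⌋ + ⌊ n /2⌋ ≤ n
⌊n/2⌋+⌊n/2⌋≤n n = ≤-trans (+-monoʳ-≤ ⌊ n /2⌋ (⌊n/2⌋≤⌈n/2⌉ n)) (≤-reflexive (⌊n/2⌋+⌈n/2⌉≡n n))

2^⌊log₂n⌋≤n : ∀ {n} → 1 ≤ n → 2 ^ ⌊log₂ n ⌋ ≤ n
2^⌊log₂n⌋≤n = <-rec (λ n → 1 ≤ n → 2 ^ ⌊log₂ n ⌋ ≤ n) step _
  where
  open ≤-Reasoning
  step : ∀ n → (∀ {h} → h < n → 1 ≤ h → 2 ^ ⌊log₂ h ⌋ ≤ h) → 1 ≤ n → 2 ^ ⌊log₂ n ⌋ ≤ n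
  step (suc zero)    _  _ = ≤-refl
  step (suc (suc m)) ih _ = begin
    2 ^ ⌊log₂ n ⌋                      ≡⟨ cong (λ l → 2 ^ suc l) (sym (⌊log₂⌊n/2⌋⌋≡⌊log₂n⌋∸1 n)) ⟩
    2 ^ suc ⌊log₂ h ⌋                  ≡⟨ 2^[1+k]≡2^k+2^k ⌊log₂ h ⌋ ⟩
    2 ^ ⌊log₂ h ⌋ + 2 ^ ⌊log₂ h ⌋      ≤⟨ +-mono-≤ 2^⌊log₂h⌋≤h 2^⌊log₂h⌋≤h ⟩
    h + h                              ≤⟨ ⌊n/2⌋+⌊n/2⌋≤n n ⟩
    n                                  ∎
    where
    n h : ℕ
    n = suc (suc m)
    h = ⌊ n /2⌋
    2^⌊log₂h⌋≤h : 2 ^ ⌊log₂ h ⌋ ≤ h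
    2^⌊log₂h⌋≤h = ih (⌊n/2⌋<n (suc m)) (s≤s z≤n)

n<2^[1+⌊log₂n⌋] : ∀ n → n < 2 ^ suc ⌊log₂ n ⌋
n<2^[1+⌊log₂n⌋] n with n <? 2 ^ suc ⌊log₂ n ⌋
... | yes lt = lt
... | no ≮  = contradiction
  (subst (_≤ ⌊log₂ n ⌋) (⌊log₂[2^n]⌋≡n (suc ⌊log₂ n ⌋)) (⌊log₂⌋-mono-≤ (≮⇒≥ ≮)))
  (n≮n ⌊log₂ n ⌋)

⌊log₂⌋-unique : ∀ {k n} → 2 ^ k ≤ n → n < 2 ^ suc k → ⌊log₂ n ⌋ ≡ k
⌊log₂⌋-unique {k} {n} lo hi = ≤-antisym ⌊log₂n⌋≤k k≤⌊log₂n⌋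
  where
  k≤⌊log₂n⌋ : k ≤ ⌊log₂ n ⌋
  k≤⌊log₂n⌋ = subst (_≤ ⌊log₂ n ⌋) (⌊log₂[2^n]⌋≡n k) (⌊log₂⌋-mono-≤ lo)
  ⌊log₂n⌋≤k : ⌊log₂ n ⌋ ≤ k
  ⌊log₂n⌋≤k = ≮⇒≥ λ k<⌊log₂n⌋ →
    <⇒≱ hi (≤-trans (^-monoʳ-≤ 2 k<⌊log₂n⌋) (2^⌊log₂n⌋≤n (≤-trans (m^n>0 2 k) lo)))

data MersenneSplit (n : ℕ) : Set where
  mersenne  : ∀ k → suc n ≡ 2 ^ suc k → MersenneSplit n
  mersenne+ : ∀ k {i} → suc n ≡ 2 ^ suc k + i → 1 ≤ i → i < 2 ^ suc k → MersenneSplit n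

mersenneSplit : ∀ n → 1 ≤ n → MersenneSplit n
mersenneSplit n 1≤n with ⌊log₂ n ⌋ | 2^⌊log₂n⌋≤n 1≤n | n<2^[1+⌊log₂n⌋] n
... | zero  | lo | hi = mersenne 0 (≤-antisym hi (s≤s lo))
... | suc k | lo | hi with suc n ≟ 2 ^ suc (suc k)
...   | yes eq = mersenne (suc k) eq
...   | no  ne = mersenne+ k (sym (m+[n∸m]≡n (m≤n⇒m≤1+n lo))) (m<n⇒0<n∸m (s≤s lo)) i<t
  where
  t : ℕ
  t = 2 ^ suc k
  i<t : suc n ∸ t < t
  i<t = +-cancelˡ-< t (suc n ∸ t) t (begin-strict
    t + (suc n ∸ t)  ≡⟨ m+[n∸m]≡n (m≤n⇒m≤1+n lo) ⟩
    suc n            <⟨ ≤∧≢⇒< hi ne ⟩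
    2 ^ suc (suc k)  ≡⟨ 2^[1+k]≡2^k+2^k (suc k) ⟩
    t + t            ∎)
    where open ≤-Reasoning

mersenne+⇒< : ∀ {n} k {i} → suc n ≡ 2 ^ suc k + i → i < n
mersenne+⇒< {n} k {i} eq = ≤-pred (begin
  suc (suc i)      ≤⟨ +-monoˡ-≤ i (2≤2^[1+k] k) ⟩
  2 ^ suc k + i    ≡⟨ sym eq ⟩
  suc n            ∎)
  where open ≤-Reasoning

if-≡ : ∀ {A : Set} {m n} {x y : A} → m ≡ n → (if m ≡ᵇ n then x else y) ≡ x
if-≡ {m = m} {n} eq with m ≡ᵇ n | ≡⇒≡ᵇ m n eq
... | true | _ = refl

if-≢ : ∀ {A : Set} {m n} {x y : A} → m ≢ n → (if m ≡ᵇ n then x else y) ≡ y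
if-≢ {m = m} {n} ne with m ≡ᵇ n | ≡ᵇ⇒≡ m n
... | true  | to≡ = contradiction (to≡ _) ne
... | false | _   = refl

⌊log₂⌋-mersenne : ∀ {n} k → suc n ≡ 2 ^ suc k → ⌊log₂ n ⌋ ≡ k
⌊log₂⌋-mersenne {n} k eq = ⌊log₂⌋-unique (≤-pred (begin
  1 + 2 ^ k        ≤⟨ +-monoˡ-≤ (2 ^ k) (m^n>0 2 k) ⟩
  2 ^ k + 2 ^ k    ≡⟨ sym (2^[1+k]≡2^k+2^k k) ⟩
  2 ^ suc k        ≡⟨ sym eq ⟩
  suc n            ∎)) (≤-reflexive eq)
  where open ≤-Reasoning

mersenne+⇒1+n<2^[2+k] : ∀ {n} k {i} → suc n ≡ 2 ^ suc k + i → i < 2 ^ suc k → suc n < 2 ^ suc (suc k)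
mersenne+⇒1+n<2^[2+k] {n} k {i} eq i<t = begin-strict
  suc n                      ≡⟨ eq ⟩
  2 ^ suc k + i              <⟨ +-monoʳ-< (2 ^ suc k) i<t ⟩
  2 ^ suc k + 2 ^ suc k      ≡⟨ sym (2^[1+k]≡2^k+2^k (suc k)) ⟩
  2 ^ suc (suc k)            ∎
  where open ≤-Reasoning

⌊log₂⌋-mersenne+ : ∀ {n} k {i} → suc n ≡ 2 ^ suc k + i → 1 ≤ i → i < 2 ^ suc k → ⌊log₂ n ⌋ ≡ suc k
⌊log₂⌋-mersenne+ {n} k {i} eq 1≤i i<t =
  ⌊log₂⌋-unique t≤n (<-trans (n<1+n n) (mersenne+⇒1+n<2^[2+k] k eq i<t))
  where
  open ≤-Reasoning
  t : ℕ
  t = 2 ^ suc k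
  t≤n : t ≤ n
  t≤n = ≤-pred (begin
    suc t    ≡⟨ +-comm 1 t ⟩
    t + 1    ≤⟨ +-monoʳ-≤ t 1≤i ⟩
    t + i    ≡⟨ sym eq ⟩
    suc n    ∎)

a-fuel-mersenne : ∀ f {n} k → suc n ≡ 2 ^ suc k → a-fuel (suc f) n ≡ 2 ^ k
a-fuel-mersenne f k eq rewrite ⌊log₂⌋-mersenne k eq = if-≡ eq

a-fuel-mersenne+ : ∀ f {n} k {i} → suc n ≡ 2 ^ suc k + i → 1 ≤ i → i < 2 ^ suc k →
                   a-fuel (suc f) n ≡ 2 ^ k + a-fuel f i
a-fuel-mersenne+ f k {i} eq 1≤i i<t rewrite ⌊log₂⌋-mersenne+ k eq 1≤i i<t =
  trans (if-≢ (<⇒≢ (mersenne+⇒1+n<2^[2+k] k eq i<t)))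
        (cong (λ j → 2 ^ k + a-fuel f j) (trans (cong (_∸ 2 ^ suc k) eq) (m+n∸m≡n (2 ^ suc k) i)))

a-fuel-irrelevant : ∀ {f g n} → 1 ≤ n → n ≤ f → n ≤ g → a-fuel f n ≡ a-fuel g n
a-fuel-irrelevant {zero}          (s≤s _) () _
a-fuel-irrelevant {suc _} {zero}  (s≤s _) _ ()
a-fuel-irrelevant {suc f} {suc g} {n} 1≤n n≤1+f n≤1+g with mersenneSplit n 1≤n
... | mersenne k eq = trans (a-fuel-mersenne f k eq) (sym (a-fuel-mersenne g k eq))
... | mersenne+ k {i} eq 1≤i i<t = begin
  a-fuel (suc f) n      ≡⟨ a-fuel-mersenne+ f k eq 1≤i i<t ⟩
  2 ^ k + a-fuel f i    ≡⟨ cong (2 ^ k +_) (a-fuel-irrelevant 1≤i (i≤ n≤1+f) (i≤ n≤1+g)) ⟩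
  2 ^ k + a-fuel g i    ≡⟨ sym (a-fuel-mersenne+ g k eq 1≤i i<t) ⟩
  a-fuel (suc g) n      ∎
  where
  open ≡-Reasoning
  i≤ : ∀ {h} → n ≤ suc h → i ≤ h
  i≤ n≤1+h = ≤-pred (≤-trans (mersenne+⇒< k eq) n≤1+h)

a-mersenne : ∀ {n} k → suc n ≡ 2 ^ suc k → a n ≡ 2 ^ k
a-mersenne {zero}  k eq = contradiction eq (<⇒≢ (2≤2^[1+k] k))
a-mersenne {suc m} k eq = a-fuel-mersenne m k eq

a-mersenne+ : ∀ {n} k {i} → suc n ≡ 2 ^ suc k + i → 1 ≤ i → i < 2 ^ suc k → a n ≡ 2 ^ k + a i
a-mersenne+ {zero}  k eq _   _   = contradiction (mersenne+⇒< k eq) n≮0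
a-mersenne+ {suc m} k eq 1≤i i<t =
  trans (a-fuel-mersenne+ m k eq 1≤i i<t)
        (cong (2 ^ k +_) (a-fuel-irrelevant 1≤i (≤-pred (mersenne+⇒< k eq)) ≤-refl))

-- n ≤ 2m − s₂ m, written without truncated subtraction; by Legendre's formula 2m − s₂ m is
-- the 2-adic valuation of (2m)!.
infix 4 _⊑_

_⊑_ : ℕ → ℕ → Set
n ⊑ m = n + s₂ m ≤ m + m

⊑-+ : ∀ {n₁ n₂ m₁ m₂} → n₁ ⊑ m₁ → n₂ ⊑ m₂ → n₁ + n₂ ⊑ m₁ + m₂
⊑-+ {n₁} {n₂} {m₁} {m₂} n₁⊑m₁ n₂⊑m₂ = begin
  (n₁ + n₂) + s₂ (m₁ + m₂)        ≤⟨ +-monoʳ-≤ (n₁ + n₂) (s₂-subadditive m₁ m₂) ⟩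
  (n₁ + n₂) + (s₂ m₁ + s₂ m₂)     ≡⟨ interchange n₁ n₂ (s₂ m₁) (s₂ m₂) ⟩
  (n₁ + s₂ m₁) + (n₂ + s₂ m₂)     ≤⟨ +-mono-≤ n₁⊑m₁ n₂⊑m₂ ⟩
  (m₁ + m₁) + (m₂ + m₂)           ≡⟨ interchange m₁ m₁ m₂ m₂ ⟩
  (m₁ + m₂) + (m₁ + m₂)           ∎
  where open ≤-Reasoning

<2^[1+k]⇒⊑2^k : ∀ {n} k → n < 2 ^ suc k → n ⊑ 2 ^ k
<2^[1+k]⇒⊑2^k {n} k n<2^[1+k] = begin
  n + s₂ (2 ^ k)     ≡⟨ cong (n +_) (s₂[2^k]≡1 k) ⟩
  n + 1              ≡⟨ +-comm n 1 ⟩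
  suc n              ≤⟨ n<2^[1+k] ⟩
  2 ^ suc k          ≡⟨ 2^[1+k]≡2^k+2^k k ⟩
  2 ^ k + 2 ^ k      ∎
  where open ≤-Reasoning

⊑⇒2^k≤ : ∀ {n m} k → 2 ^ suc k ≤ suc n → n ⊑ m → 2 ^ k ≤ m
⊑⇒2^k≤ {n} {m} k 2^[1+k]≤1+n n⊑m = m+m≤1+n+n⇒m≤n (begin
  2 ^ k + 2 ^ k      ≡⟨ sym (2^[1+k]≡2^k+2^k k) ⟩
  2 ^ suc k          ≤⟨ 2^[1+k]≤1+n ⟩
  suc n              ≤⟨ s≤s (m+n≤o⇒m≤o n n⊑m) ⟩
  suc (m + m)        ∎)
  where open ≤-Reasoning

⊑-cancel-2^k : ∀ {n m i} k → suc n ≡ 2 ^ suc k + i → m < 2 ^ k → n ⊑ 2 ^ k + m → i ⊑ m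
⊑-cancel-2^k {n} {m} {i} k eq m<2^k n⊑2^k+m = +-cancelˡ-≤ (t + t) _ _ (begin
  (t + t) + (i + s₂ m)     ≡⟨ sym (+-assoc (t + t) i (s₂ m)) ⟩
  ((t + t) + i) + s₂ m     ≡⟨ cong (λ u → u + i + s₂ m) (sym (2^[1+k]≡2^k+2^k k)) ⟩
  (2 ^ suc k + i) + s₂ m   ≡⟨ cong (_+ s₂ m) (sym eq) ⟩
  suc n + s₂ m             ≡⟨ sym (+-suc n (s₂ m)) ⟩
  n + suc (s₂ m)           ≡⟨ cong (n +_) (sym (s₂[2^k+n]≡1+s₂n k m<2^k)) ⟩
  n + s₂ (t + m)           ≤⟨ n⊑2^k+m ⟩
  (t + m) + (t + m)        ≡⟨ interchange t m t m ⟩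
  (t + t) + (m + m)        ∎)
  where
  open ≤-Reasoning
  t : ℕ
  t = 2 ^ k

a-⊑ : ∀ {n} → 1 ≤ n → n ⊑ a n
a-⊑ = <-rec (λ n → 1 ≤ n → n ⊑ a n) step _
  where
  step : ∀ n → (∀ {i} → i < n → 1 ≤ i → i ⊑ a i) → 1 ≤ n → n ⊑ a n
  step n ih 1≤n with mersenneSplit n 1≤n
  ... | mersenne k eq =
    subst (n ⊑_) (sym (a-mersenne k eq)) (<2^[1+k]⇒⊑2^k k (≤-reflexive eq))
  ... | mersenne+ k {i} eq 1≤i i<t =
    subst₂ _⊑_ r+i≡n (sym (a-mersenne+ k eq 1≤i i<t))
      (⊑-+ {m₁ = 2 ^ k} {a i} (<2^[1+k]⇒⊑2^k k r<t) (ih (mersenne+⇒< k eq) 1≤i))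
    where
    t r : ℕ
    t = 2 ^ suc k
    r = pred t
    1+r≡t : suc r ≡ t
    1+r≡t = suc-pred t {{m^n≢0 2 (suc k)}}
    r<t : r < t
    r<t = ≤-reflexive 1+r≡t
    r+i≡n : r + i ≡ n
    r+i≡n = suc-injective (trans (cong (_+ i) 1+r≡t) (sym eq))

a-least : ∀ {n m} → 1 ≤ n → n ⊑ m → a n ≤ m
a-least = <-rec (λ n → ∀ {m} → 1 ≤ n → n ⊑ m → a n ≤ m) step _
  where
  step : ∀ n → (∀ {i} → i < n → ∀ {m} → 1 ≤ i → i ⊑ m → a i ≤ m) → ∀ {m} → 1 ≤ n → n ⊑ m → a n ≤ m
  step n ih {m} 1≤n n⊑m with mersenneSplit n 1≤n
  ... | mersenne k eq =
    subst (_≤ m) (sym (a-mersenne k eq)) (⊑⇒2^k≤ k (≤-reflexive (sym eq)) n⊑m)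
  ... | mersenne+ k {i} eq 1≤i i<t = begin
    a n          ≡⟨ a-mersenne+ k eq 1≤i i<t ⟩
    h + a i      ≤⟨ +-monoʳ-≤ h ai≤m′ ⟩
    h + m′       ≡⟨ m+[n∸m]≡n h≤m ⟩
    m            ∎
    where
    open ≤-Reasoning
    h m′ : ℕ
    h = 2 ^ k
    m′ = m ∸ h
    h≤m : h ≤ m
    h≤m = ⊑⇒2^k≤ k (≤-trans (m≤m+n (2 ^ suc k) i) (≤-reflexive (sym eq))) n⊑m
    ai≤m′ : a i ≤ m′
    ai≤m′ with m′ <? h
    ... | yes m′<h = ih (mersenne+⇒< k eq) 1≤i
                        (⊑-cancel-2^k k eq m′<h (subst (n ⊑_) (sym (m+[n∸m]≡n h≤m)) n⊑m))
    ... | no  m′≮h = ≤-trans (ih (mersenne+⇒< k eq) 1≤i (<2^[1+k]⇒⊑2^k k i<t)) (≮⇒≥ m′≮h)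

corollary4p3 : (n₁ n₂ : ℕ) → 1 ≤ n₁ → 1 ≤ n₂ → a (n₁ + n₂) ≤ a n₁ + a n₂
corollary4p3 n₁ n₂ 1≤n₁ 1≤n₂ =
  a-least (≤-trans 1≤n₁ (m≤m+n n₁ n₂)) (⊑-+ {n₁} {n₂} {a n₁} {a n₂} (a-⊑ 1≤n₁) (a-⊑ 1≤n₂))
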